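{- Let $\mathcal{M}=(R,\mathcal{I})$ be a matroid with $R=\{r^1,\dots,r^n\}$ and $r^1\succ\dots\succ r^n$. (a) Let the elements arrive in uniformly random order $r_1,\dots,r_n$, let $s\sim\mathrm{Bin}(n,1/2)$ be independent of the order, $R_s=\{r_1,\dots,r_s\}$, and $R_s^+=\{r\in R\setminus R_s: r\in\mathrm{OPT}(R_s\cup\{r\})\}$. (b) Let $X_1,\dots,X_n$ be independent random variables with $\Pr(X_i=0)=\Pr(X_i=1)=1/2$, and construct $V,W\subseteq R$ as follows: start with $V=W=\emptyset$; for $i=1,\dots,n$, if $r^i\in\mathrm{OPT}(V\cup\{r^i\})$ then add $r^i$ to $V$ if $X_i=0$ and to $W$ if $X_i=1$ (otherwise do nothing). Then $(V,W)$ has the same distribution as $(\mathrm{OPT}(R_s),R_s^+)$.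
   Context: For $Q\subseteq R$, $\mathrm{OPT}(Q)$ denotes the base of $Q$ obtained by the greedy algorithm scanning $Q$ in decreasing $\succ$-order (the lexicographically maximum base of $Q$). -}

module Defs where

open import Level using (Level; suc; _⊔_)
open import Data.Nat as ℕ using (ℕ; zero; _+_; _*_; _^_; _<_; _!)
open import Data.Nat.ListAction using (sum)
open import Data.Nat.Combinatorics using (_C_)
open import Data.Bool using (Bool; true; false; if_then_else_)
import Data.Bool as Bool
open import Data.Fin using (Fin)
open import Data.Fin.Subset using (Subset; ⊥; ⁅_⁆; _∪_; _∈_; _∉_; _⊆_; ∣_∣)
open import Data.Fin.Subset.Properties using (_∈?_)
open import Data.List using (List; []; _∷_; take; allFin; upTo; concatMap; map; length; filter; foldl)
open import Data.Vec as Vec using (Vec; lookup)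
open import Data.Vec.Properties using (≡-dec)
open import Data.Product using (_×_; _,_; ∃)
open import Data.Product.Properties renaming (≡-dec to ×-≡-dec) using ()
open import Relation.Nullary using (Dec; yes; no; ¬_; does)
open import Relation.Unary using (Decidable)
open import Relation.Binary.PropositionalEquality using (_≡_)

-- Element i : Fin n stands for r^(i+1); the order r^1 ≻ … ≻ r^n is the index order
-- (smaller index = larger in ≻).  Independence is assumed decidable (finite matroid,
-- needed to run the greedy algorithm constructively).
record Matroid (n : ℕ) : Set₁ where
  field
    Indep        : Subset n → Set
    indep?       : Decidable Indep
    indep-∅      : Indep ⊥
    hereditary   : ∀ {A B} → A ⊆ B → Indep B → Indep A
    exchange     : ∀ {A B} → Indep A → Indep B → ∣ A ∣ < ∣ B ∣ →
                   ∃ λ x → x ∈ B × x ∉ A × Indep (⁅ x ⁆ ∪ A)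
open Matroid public

module _ {n : ℕ} (M : Matroid n) where

  -- OPT(Q): greedy scanning Q in decreasing ≻-order, i.e. index order 0,1,…,n-1.
  OPT : Subset n → Subset n
  OPT Q = foldl step ⊥ (allFin n)
    where
    step : Subset n → Fin n → Subset n
    step B i with i ∈? Q | indep? M (⁅ i ⁆ ∪ B)
    ... | yes _ | yes _ = ⁅ i ⁆ ∪ B
    ... | _     | _     = B

  mem : Fin n → Subset n → Bool
  mem i Q with i ∈? Q
  ... | yes _ = true
  ... | no  _ = false

  setOf : List (Fin n) → Subset n
  setOf = foldl (λ S i → ⁅ i ⁆ ∪ S) ⊥

  Rs : List (Fin n) → ℕ → Subset n
  Rs σ s = setOf (take s σ)

  Rs⁺ : Subset n → Subset n
  Rs⁺ S = Vec.tabulate λ r →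
    if mem r S then false else mem r (OPT (S ∪ ⁅ r ⁆))

  processA : List (Fin n) → ℕ → Subset n × Subset n
  processA σ s = OPT (Rs σ s) , Rs⁺ (Rs σ s)

  -- Process (b): coin flips X (X_i = 1 encoded as true).
  processB : Vec Bool n → Subset n × Subset n
  processB X = foldl step (⊥ , ⊥) (allFin n)
    where
    step : Subset n × Subset n → Fin n → Subset n × Subset n
    step (V , W) i with mem i (OPT (V ∪ ⁅ i ⁆)) | lookup X i
    ... | true  | false = (V ∪ ⁅ i ⁆ , W)
    ... | true  | true  = (V , W ∪ ⁅ i ⁆)
    ... | false | _     = (V , W)

insertions : ∀ {A : Set} → A → List A → List (List A)
insertions x []       = (x ∷ []) ∷ []
insertions x (y ∷ ys) = (x ∷ y ∷ ys) ∷ map (y ∷_) (insertions x ys)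

perms : ∀ {A : Set} → List A → List (List A)
perms []       = [] ∷ []
perms (x ∷ xs) = concatMap (insertions x) (perms xs)

allBits : (n : ℕ) → List (Vec Bool n)
allBits zero      = Vec.[] ∷ []
allBits (ℕ.suc n) = concatMap (λ v → (false Vec.∷ v) ∷ (true Vec.∷ v) ∷ []) (allBits n)

_≟P_ : ∀ {n} (p q : Subset n × Subset n) → Dec (p ≡ q)
_≟P_ = ×-≡-dec (≡-dec Bool._≟_) (≡-dec Bool._≟_)

-- Pr_a[(OPT(R_s), R_s^+) = p] = probA-num M p / (n! · 2^n):
-- each (order σ, s) has probability (1/n!) · (n C s)/2^n.
probA-num : ∀ {n} → Matroid n → Subset n × Subset n → ℕ
probA-num {n} M p =
  sum (concatMap (λ σ → map (λ s → if does (processA M σ s ≟P p) then n C s else 0)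
                             (upTo (ℕ.suc n)))
                 (perms (allFin n)))

-- Pr_b[(V, W) = p] = probB-num M p / 2^n.
probB-num : ∀ {n} → Matroid n → Subset n × Subset n → ℕ
probB-num {n} M p = length (filter (λ X → processB M X ≟P p) (allBits n))

denomA : ℕ → ℕ
denomA n = (n !) * 2 ^ n

denomB : ℕ → ℕ
denomB n = 2 ^ n

module Submission where

-- Both pairs are the same function of a uniformly random subset S of R.
--
-- (b) V consists of earlier elements and stays independent, so the greedy scan of V ∪ {r^i}
-- reproduces V before reaching r^i, and r^i ∈ OPT(V ∪ {r^i}) iff V + r^i is independent.  As the
-- greedy scan of Q ∪ {r^i} agrees with that of Q before r^i, this is also the condition for r^i to
-- enter OPT(S) (if X_i = 0) or S⁺ (if X_i = 1), where S = {r^i : X_i = 0}.  Hence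
-- (V , W) = (OPT(S) , S⁺).
--
-- (a) R_s is uniform.  Of the L + 1 ways to insert a new element x into an arrival order of L
-- elements, s put x among the first s arrivals, and the absorption identities
-- s·C(L+1,s) = (L+1)·C(L,s-1) and (L+1-s)·C(L+1,s) = (L+1)·C(L,s) reduce the binomial weights for
-- L + 1 elements to those for L; by induction, Σ_σ Σ_s C(n,s)·f(R_s) = n!·Σ_S f(S).

open import Algebra.Bundles using (CommutativeMonoid)
open import Data.Bool using (Bool; true; false; not; _∧_; _∨_; if_then_else_)
open import Data.Bool.Properties using (∨-zeroʳ; ∨-identityʳ; ∧-zeroʳ; ∧-identityʳ; not-involutive)
open import Data.Fin as Fin using (Fin; _≟_)
open import Data.Fin.Subset using (Subset; ⊥; ⊤; ⁅_⁆; _∪_; _∩_; _∈_; _⊆_)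
open import Data.Fin.Subset.Properties
  using (_∈?_; ∪-commutativeMonoid; ∪-comm; ∪-identityˡ; ∩-zeroˡ; ∩-zeroʳ; ∩-comm; ∩-identityˡ;
         ∩-distribˡ-∪; ∩-distribʳ-∪; ⊆-antisym; ⊆⊤; p∩q⊆p; x∈⁅y⁆⇒x≡y; x∈p∩q⁺; x∈p∪q⁺; x∈p∪q⁻;
         x∈⁅x⁆)
open import Data.List
  using (List; []; _∷_; _++_; _∷ʳ_; map; concatMap; upTo; foldl; take; length; filter; tabulate; allFin)
open import Data.List.Properties
  using (foldl-cong; foldl-∷ʳ; foldl-++; ++-assoc; ++-identityʳ; length-tabulate; map-tabulate;
         map-upTo; map-applyUpTo; upTo-∷ʳ)
import Data.List.Membership.Propositional as List
open import Data.List.Membership.Propositional.Properties using (∈-allFin; ∈-upTo⁻; ∈-++⁺ʳ)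
open import Data.List.Relation.Unary.All as All using (All; []; _∷_)
open import Data.List.Relation.Unary.All.Properties using (concat⁺; map⁺)
open import Data.List.Relation.Unary.AllPairs using (_∷_)
open import Data.List.Relation.Unary.Any using (here; there)
open import Data.List.Relation.Unary.Unique.Propositional using (Unique)
open import Data.List.Relation.Unary.Unique.Propositional.Properties using (allFin⁺; Unique[x∷xs]⇒x∉xs)
open import Data.List.Reverse using (Reverse; []; _∶_∶ʳ_; reverseView)
open import Data.Nat using (ℕ; zero; suc; _+_; _*_; _∸_; _^_; _≤_; s≤s; z≤n; pred; _!)
open import Data.Nat.Combinatorics using (_C_; k>n⇒nCk≡0; nCk+nC[k+1]≡[n+1]C[k+1]; nC1≡n)
open import Data.Nat.ListAction using (sum)
open import Data.Nat.ListAction.Properties using (sum-++)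
open import Data.Nat.Properties
  using (+-assoc; +-identityʳ; *-identityˡ; *-identityʳ; *-zeroʳ; *-comm; *-assoc; *-distribˡ-+;
         +-cancelˡ-≡; ≤-<-connex; ≤-pred; <⇒≤; m≤n⇒m∸n≡0; m<n⇒m<1+n; m+[n∸m]≡n; n<1+n;
         +-commutativeSemigroup)
open import Data.Nat.Tactic.RingSolver using (solve-∀)
open import Algebra.Properties.CommutativeSemigroup +-commutativeSemigroup
  using () renaming (interchange to +-interchange)
open import Data.Product using (∃; _×_; _,_; proj₁; proj₂)
open import Data.Sum as Sum using (inj₁; inj₂)
open import Data.Vec as Vec using (Vec; lookup)
open import Data.Vec.Properties
  using (lookup-zipWith; lookup-replicate; lookup-map; lookup∘tabulate; lookup⇒[]=)
open import Function using (_∘_)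
open import Relation.Nullary using (does; yes; no)
open import Relation.Nullary.Decidable using (dec-true; dec-false)
open import Relation.Unary using (Decidable)
open import Relation.Binary.PropositionalEquality

open import Defs

-- Finite sums

private
  variable
    A B : Set

∑∈ : List A → (A → ℕ) → ℕ
∑∈ l f = sum (map f l)

syntax ∑∈ l (λ a → e) = ∑[ a ∈ l ] e

∑-++ : ∀ l l′ (f : A → ℕ) → ∑[ a ∈ l ++ l′ ] f a ≡ ∑[ a ∈ l ] f a + ∑[ a ∈ l′ ] f a
∑-++ []      l′ f = refl
∑-++ (a ∷ l) l′ f = trans (cong (f a +_) (∑-++ l l′ f)) (sym (+-assoc (f a) _ _))

∑-cong : ∀ l {f g : A → ℕ} → (∀ {a} → a List.∈ l → f a ≡ g a) → ∑[ a ∈ l ] f a ≡ ∑[ a ∈ l ] g a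
∑-cong []      e = refl
∑-cong (a ∷ l) e = cong₂ _+_ (e (here refl)) (∑-cong l (e ∘ there))

∑-zero : ∀ (l : List A) → ∑[ a ∈ l ] 0 ≡ 0
∑-zero []      = refl
∑-zero (a ∷ l) = ∑-zero l

∑-distrib-+ : ∀ l (f g : A → ℕ) → ∑[ a ∈ l ] (f a + g a) ≡ ∑[ a ∈ l ] f a + ∑[ a ∈ l ] g a
∑-distrib-+ []      f g = refl
∑-distrib-+ (a ∷ l) f g = trans (cong (f a + g a +_) (∑-distrib-+ l f g)) (+-interchange (f a) (g a) _ _)

∑-distribˡ-* : ∀ l c (f : A → ℕ) → ∑[ a ∈ l ] (c * f a) ≡ c * ∑[ a ∈ l ] f a
∑-distribˡ-* []      c f = sym (*-zeroʳ c)
∑-distribˡ-* (a ∷ l) c f = trans (cong (c * f a +_) (∑-distribˡ-* l c f)) (sym (*-distribˡ-+ c (f a) _))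

∑-comm : ∀ l (m : List B) (g : A → B → ℕ) →
         ∑[ a ∈ l ] ∑[ b ∈ m ] g a b ≡ ∑[ b ∈ m ] ∑[ a ∈ l ] g a b
∑-comm []      m g = sym (∑-zero m)
∑-comm (a ∷ l) m g = trans (cong (∑[ b ∈ m ] g a b +_) (∑-comm l m g)) (sym (∑-distrib-+ m (g a) _))

∑-map : ∀ (h : B → A) l (f : A → ℕ) → ∑[ a ∈ map h l ] f a ≡ ∑[ b ∈ l ] f (h b)
∑-map h []      f = refl
∑-map h (b ∷ l) f = cong (f (h b) +_) (∑-map h l f)

∑-concatMap : ∀ (g : B → List A) l (f : A → ℕ) →
              ∑[ a ∈ concatMap g l ] f a ≡ ∑[ b ∈ l ] ∑[ a ∈ g b ] f a
∑-concatMap g []      f = refl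
∑-concatMap g (b ∷ l) f = trans (∑-++ (g b) (concatMap g l) f) (cong (∑[ a ∈ g b ] f a +_) (∑-concatMap g l f))

sum-concatMap : ∀ (g : A → List ℕ) l → sum (concatMap g l) ≡ ∑[ a ∈ l ] sum (g a)
sum-concatMap g []      = refl
sum-concatMap g (a ∷ l) = trans (sum-++ (g a) (concatMap g l)) (cong (sum (g a) +_) (sum-concatMap g l))

∑< : ℕ → (ℕ → ℕ) → ℕ
∑< m f = ∑[ i ∈ upTo m ] f i

syntax ∑< m (λ i → e) = ∑[ i < m ] e

∑<-suc : ∀ m (f : ℕ → ℕ) → ∑[ i < suc m ] f i ≡ f 0 + ∑[ i < m ] f (suc i)
∑<-suc m f = cong (λ l → f 0 + sum l) (trans (map-applyUpTo suc f m) (sym (map-upTo (f ∘ suc) m)))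

∑<-suc-last : ∀ m (f : ℕ → ℕ) → f m ≡ 0 → ∑[ i < suc m ] f i ≡ ∑[ i < m ] f i
∑<-suc-last m f fm≡0 = begin
  ∑[ i ∈ upTo (suc m) ] f i           ≡⟨ cong (λ l → ∑[ i ∈ l ] f i) (upTo-∷ʳ m) ⟨
  ∑[ i ∈ upTo m ++ m ∷ [] ] f i       ≡⟨ ∑-++ (upTo m) (m ∷ []) f ⟩
  ∑[ i < m ] f i + (f m + 0)          ≡⟨ cong (λ z → ∑[ i < m ] f i + (z + 0)) fm≡0 ⟩
  ∑[ i < m ] f i + 0                  ≡⟨ +-identityʳ _ ⟩
  ∑[ i < m ] f i                      ∎
  where open ≡-Reasoning

∪-swap : ∀ {n} (p q r : Subset n) → p ∪ (q ∪ r) ≡ q ∪ (p ∪ r)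
∪-swap {n} = x∙yz≈y∙xz
  where open import Algebra.Properties.CommutativeSemigroup
                      (CommutativeMonoid.commutativeSemigroup (∪-commutativeMonoid n))

lookup-⁅⁆ : ∀ {n} (x y : Fin n) → lookup ⁅ x ⁆ y ≡ does (x ≟ y)
lookup-⁅⁆ Fin.zero    Fin.zero    = refl
lookup-⁅⁆ Fin.zero    (Fin.suc y) = lookup-replicate y false
lookup-⁅⁆ (Fin.suc x) Fin.zero    = refl
lookup-⁅⁆ (Fin.suc x) (Fin.suc y) = lookup-⁅⁆ x y

does-∈? : ∀ {n} (x : Fin n) p → does (x ∈? p) ≡ lookup p x
does-∈? Fin.zero    (true  Vec.∷ p) = refl
does-∈? Fin.zero    (false Vec.∷ p) = refl
does-∈? (Fin.suc x) (b     Vec.∷ p) = does-∈? x p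

⁅⁆-∩ : ∀ {n} (x : Fin n) p → ⁅ x ⁆ ∩ p ≡ (if lookup p x then ⁅ x ⁆ else ⊥)
⁅⁆-∩ Fin.zero    (true  Vec.∷ p) = cong (true Vec.∷_) (∩-zeroˡ p)
⁅⁆-∩ Fin.zero    (false Vec.∷ p) = cong (false Vec.∷_) (∩-zeroˡ p)
⁅⁆-∩ (Fin.suc x) (b     Vec.∷ p) rewrite ⁅⁆-∩ x p with lookup p x
... | true  = refl
... | false = refl

p⊆q⇒p∩q≡p : ∀ {n} {p q : Subset n} → p ⊆ q → p ∩ q ≡ p
p⊆q⇒p∩q≡p {p = p} {q} p⊆q = ⊆-antisym (p∩q⊆p p q) (λ x∈p → x∈p∩q⁺ (x∈p , p⊆q x∈p))

lookup-∪⁅⁆ : ∀ {n} (p : Subset n) x y → lookup (p ∪ ⁅ x ⁆) y ≡ lookup p y ∨ does (x ≟ y)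
lookup-∪⁅⁆ p x y = trans (lookup-zipWith _∨_ y p ⁅ x ⁆) (cong (lookup p y ∨_) (lookup-⁅⁆ x y))

lookup-if-∪ : ∀ {n} (c : Bool) (z x : Fin n) B →
              lookup (if c then ⁅ z ⁆ ∪ B else B) x ≡ (c ∧ does (z ≟ x)) ∨ lookup B x
lookup-if-∪ true  z x B = trans (lookup-zipWith _∨_ x ⁅ z ⁆ B) (cong (_∨ lookup B x) (lookup-⁅⁆ z x))
lookup-if-∪ false z x B = refl

Unique[xs++x∷ys]⇒x∉xs×x∉ys : ∀ {A : Set} xs {x : A} ys → Unique (xs ++ x ∷ ys) → x List.∉ xs × x List.∉ ys
Unique[xs++x∷ys]⇒x∉xs×x∉ys []       ys u = (λ ()) , Unique[x∷xs]⇒x∉xs u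
Unique[xs++x∷ys]⇒x∉xs×x∉ys (y ∷ xs) ys u@(_ ∷ u′) with Unique[xs++x∷ys]⇒x∉xs×x∉ys xs ys u′
... | x∉xs , x∉ys = (λ { (here refl)  → Unique[x∷xs]⇒x∉xs u (∈-++⁺ʳ xs (here refl))
                        ; (there x∈xs) → x∉xs x∈xs })
                  , x∉ys

module _ {n : ℕ} where

  -- Defs.setOf without its unused matroid parameter; the two are definitionally equal.
  elems : List (Fin n) → Subset n
  elems = foldl (λ S i → ⁅ i ⁆ ∪ S) ⊥

  foldl-∪ : ∀ (p q : Subset n) l → foldl (λ S i → ⁅ i ⁆ ∪ S) (p ∪ q) l ≡ p ∪ foldl (λ S i → ⁅ i ⁆ ∪ S) q l
  foldl-∪ p q []      = refl
  foldl-∪ p q (y ∷ l) =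
    trans (cong (λ S → foldl (λ S i → ⁅ i ⁆ ∪ S) S l) (∪-swap ⁅ y ⁆ p q)) (foldl-∪ p (⁅ y ⁆ ∪ q) l)

  elems-∷ : ∀ x l → elems (x ∷ l) ≡ ⁅ x ⁆ ∪ elems l
  elems-∷ x = foldl-∪ ⁅ x ⁆ ⊥

  ∈-elems : ∀ {x : Fin n} {l} → x List.∈ l → x ∈ elems l
  ∈-elems {l = y ∷ l} (here refl) = subst (_ ∈_) (sym (elems-∷ y l)) (x∈p∪q⁺ (inj₁ (x∈⁅x⁆ y)))
  ∈-elems {l = y ∷ l} (there x∈l) = subst (_ ∈_) (sym (elems-∷ y l)) (x∈p∪q⁺ (inj₂ (∈-elems x∈l)))

  elems-allFin : elems (allFin n) ≡ ⊤
  elems-allFin = ⊆-antisym ⊆⊤ (λ {x} _ → ∈-elems (∈-allFin x))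

  elems-∷ʳ : ∀ (l : List (Fin n)) x → elems (l ∷ʳ x) ≡ ⁅ x ⁆ ∪ elems l
  elems-∷ʳ l x = foldl-∷ʳ (λ S i → ⁅ i ⁆ ∪ S) ⊥ x l

-- R_s is a uniformly random subset

[1+n]C[1+k]*[1+k]≡[1+n]*nCk : ∀ n k → (suc n C suc k) * suc k ≡ suc n * (n C k)
[1+n]C[1+k]*[1+k]≡[1+n]*nCk zero    zero    = refl
[1+n]C[1+k]*[1+k]≡[1+n]*nCk zero    (suc k) = refl
[1+n]C[1+k]*[1+k]≡[1+n]*nCk (suc n) zero    = cong (_* 1) (nC1≡n (suc (suc n)))
[1+n]C[1+k]*[1+k]≡[1+n]*nCk (suc n) (suc k) = begin
  (suc (suc n) C (2 + k)) * (2 + k)        ≡⟨ cong (_* (2 + k)) (nCk+nC[k+1]≡[n+1]C[k+1] (suc n) (suc k)) ⟨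
  (a + b) * (2 + k)                        ≡⟨ expand a b k ⟩
  a + (a * suc k + b * suc (suc k))        ≡⟨ cong (a +_) (cong₂ _+_ ([1+n]C[1+k]*[1+k]≡[1+n]*nCk n k)
                                                                    ([1+n]C[1+k]*[1+k]≡[1+n]*nCk n (suc k))) ⟩
  a + (suc n * (n C k) + suc n * (n C suc k)) ≡⟨ cong (a +_) (sym (*-distribˡ-+ (suc n) (n C k) _)) ⟩
  a + suc n * (n C k + n C suc k)          ≡⟨ cong (λ z → a + suc n * z) (nCk+nC[k+1]≡[n+1]C[k+1] n k) ⟩
  a + suc n * a                            ∎
  where
  open ≡-Reasoning
  a = suc n C suc k
  b = suc n C suc (suc k)
  expand : ∀ a b k → (a + b) * (2 + k) ≡ a + (a * suc k + b * suc (suc k))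
  expand = solve-∀

[1+n]Ck*[1+n∸k]≡[1+n]*nCk : ∀ n k → (suc n C k) * (suc n ∸ k) ≡ suc n * (n C k)
[1+n]Ck*[1+n∸k]≡[1+n]*nCk n zero    = trans (*-identityˡ (suc n)) (sym (*-identityʳ (suc n)))
[1+n]Ck*[1+n∸k]≡[1+n]*nCk n (suc k) with ≤-<-connex k n
... | inj₂ n<k = begin
  c * (n ∸ k)           ≡⟨ cong (c *_) (m≤n⇒m∸n≡0 (<⇒≤ n<k)) ⟩
  c * 0                 ≡⟨ *-zeroʳ c ⟩
  0                     ≡⟨ *-zeroʳ (suc n) ⟨
  suc n * 0             ≡⟨ cong (suc n *_) (k>n⇒nCk≡0 (m<n⇒m<1+n n<k)) ⟨
  suc n * (n C suc k)   ∎
  where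
  open ≡-Reasoning
  c = suc n C suc k
... | inj₁ k≤n = +-cancelˡ-≡ (c * suc k) _ _ (begin
  c * suc k + c * (n ∸ k)                   ≡⟨ *-distribˡ-+ c (suc k) (n ∸ k) ⟨
  c * suc (k + (n ∸ k))                     ≡⟨ cong (λ m → c * suc m) (m+[n∸m]≡n k≤n) ⟩
  c * suc n                                 ≡⟨ *-comm c (suc n) ⟩
  suc n * c                                 ≡⟨ cong (suc n *_) (nCk+nC[k+1]≡[n+1]C[k+1] n k) ⟨
  suc n * (n C k + n C suc k)               ≡⟨ *-distribˡ-+ (suc n) (n C k) _ ⟩
  suc n * (n C k) + suc n * (n C suc k)     ≡⟨ cong (_+ suc n * (n C suc k)) ([1+n]C[1+k]*[1+k]≡[1+n]*nCk n k) ⟨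
  c * suc k + suc n * (n C suc k)           ∎)
  where
  open ≡-Reasoning
  c = suc n C suc k

∑-[1+n]Cs*s : ∀ n (f : ℕ → ℕ) →
              ∑[ s < suc (suc n) ] ((suc n C s) * s * f s) ≡ suc n * ∑[ t < suc n ] ((n C t) * f (suc t))
∑-[1+n]Cs*s n f = begin
  ∑[ s < suc (suc n) ] ((suc n C s) * s * f s)
    ≡⟨ ∑<-suc (suc n) (λ s → (suc n C s) * s * f s) ⟩
  ∑[ t < suc n ] ((suc n C suc t) * suc t * f (suc t))
    ≡⟨ ∑-cong (upTo (suc n)) (λ {t} _ → trans (cong (_* f (suc t)) ([1+n]C[1+k]*[1+k]≡[1+n]*nCk n t))
                                              (*-assoc (suc n) (n C t) (f (suc t)))) ⟩
  ∑[ t < suc n ] (suc n * ((n C t) * f (suc t)))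
    ≡⟨ ∑-distribˡ-* (upTo (suc n)) (suc n) (λ t → (n C t) * f (suc t)) ⟩
  suc n * ∑[ t < suc n ] ((n C t) * f (suc t))
    ∎
  where open ≡-Reasoning

∑-[1+n]Cs*[1+n∸s] : ∀ n (f : ℕ → ℕ) →
                    ∑[ s < suc (suc n) ] ((suc n C s) * (suc n ∸ s) * f s) ≡
                    suc n * ∑[ s < suc n ] ((n C s) * f s)
∑-[1+n]Cs*[1+n∸s] n f = begin
  ∑[ s < suc (suc n) ] ((suc n C s) * (suc n ∸ s) * f s)
    ≡⟨ ∑-cong (upTo (suc (suc n))) (λ {s} _ → trans (cong (_* f s) ([1+n]Ck*[1+n∸k]≡[1+n]*nCk n s))
                                                   (*-assoc (suc n) (n C s) (f s))) ⟩
  ∑[ s < suc (suc n) ] (suc n * ((n C s) * f s))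
    ≡⟨ ∑-distribˡ-* (upTo (suc (suc n))) (suc n) (λ s → (n C s) * f s) ⟩
  suc n * ∑[ s < suc (suc n) ] ((n C s) * f s)
    ≡⟨ cong (suc n *_) (∑<-suc-last (suc n) (λ s → (n C s) * f s) (cong (_* f (suc n)) (k>n⇒nCk≡0 (n<1+n n)))) ⟩
  suc n * ∑[ s < suc n ] ((n C s) * f s)
    ∎
  where open ≡-Reasoning

module _ {n : ℕ} where

  -- For s = 0 the first summand vanishes, so the junk value pred 0 = 0 is harmless.
  ∑-insertions : ∀ x σ s (F : Subset n → ℕ) → s ≤ suc (length σ) →
                 ∑[ τ ∈ insertions x σ ] F (elems (take s τ)) ≡
                 s * F (⁅ x ⁆ ∪ elems (take (pred s) σ)) + (suc (length σ) ∸ s) * F (elems (take s σ))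
  ∑-insertions x []       zero          F _ = refl
  ∑-insertions x []       (suc zero)    F _ = sym (+-identityʳ _)
  ∑-insertions x []       (suc (suc s)) F (s≤s ())
  ∑-insertions x (y ∷ σ)  zero          F _ =
    cong (F ⊥ +_) (trans (∑-map (y ∷_) (insertions x σ) _) (∑-insertions x σ zero F z≤n))
  ∑-insertions x (y ∷ σ)  (suc t)       F (s≤s t≤) = begin
    F (elems (x ∷ take t (y ∷ σ))) + ∑[ τ ∈ map (y ∷_) (insertions x σ) ] F (elems (take (suc t) τ))
      ≡⟨ cong₂ _+_ (cong F (elems-∷ x (take t (y ∷ σ)))) (∑-map (y ∷_) (insertions x σ) _) ⟩
    a + ∑[ τ ∈ insertions x σ ] F (elems (y ∷ take t τ))
      ≡⟨ cong (a +_) (∑-cong (insertions x σ) (λ {τ} _ → cong F (elems-∷ y (take t τ)))) ⟩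
    a + ∑[ τ ∈ insertions x σ ] Fy (elems (take t τ))
      ≡⟨ cong (a +_) (∑-insertions x σ t Fy t≤) ⟩
    a + (t * Fy (⁅ x ⁆ ∪ elems (take (pred t) σ)) + (suc (length σ) ∸ t) * Fy (elems (take t σ)))
      ≡⟨ cong (λ z → a + (z + (suc (length σ) ∸ t) * b)) (inserted-after-y t) ⟩
    a + (t * a + (suc (length σ) ∸ t) * b)
      ≡⟨ +-assoc a (t * a) _ ⟨
    suc t * a + (suc (length σ) ∸ t) * b
      ≡⟨ cong (λ S → suc t * a + (suc (length σ) ∸ t) * F S) (elems-∷ y (take t σ)) ⟨
    suc t * a + (suc (length σ) ∸ t) * F (elems (y ∷ take t σ))
      ∎
    where
    open ≡-Reasoning
    Fy : Subset n → ℕ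
    Fy S = F (⁅ y ⁆ ∪ S)
    a = F (⁅ x ⁆ ∪ elems (take t (y ∷ σ)))
    b = Fy (elems (take t σ))
    inserted-after-y : ∀ k → k * Fy (⁅ x ⁆ ∪ elems (take (pred k) σ)) ≡
                             k * F (⁅ x ⁆ ∪ elems (take k (y ∷ σ)))
    inserted-after-y zero    = refl
    inserted-after-y (suc k) = cong (λ S → suc k * F S)
      (trans (∪-swap ⁅ y ⁆ ⁅ x ⁆ _) (cong (⁅ x ⁆ ∪_) (sym (elems-∷ y (take k σ)))))

  length-insertions : ∀ (x : Fin n) σ → All (λ τ → length τ ≡ suc (length σ)) (insertions x σ)
  length-insertions x []      = refl ∷ []
  length-insertions x (y ∷ σ) = refl ∷ map⁺ (All.map (cong suc) (length-insertions x σ))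

  length-perms : ∀ (xs : List (Fin n)) → All (λ σ → length σ ≡ length xs) (perms xs)
  length-perms []       = refl ∷ []
  length-perms (x ∷ xs) = concat⁺ (map⁺ (All.map
    (λ {σ} eq → All.map (λ eq′ → trans eq′ (cong suc eq)) (length-insertions x σ)) (length-perms xs)))

  sumSubsetsOf : List (Fin n) → (Subset n → ℕ) → ℕ
  sumSubsetsOf []       F = F ⊥
  sumSubsetsOf (x ∷ xs) F = sumSubsetsOf xs (λ S → F (⁅ x ⁆ ∪ S)) + sumSubsetsOf xs F

  sumSubsetsOf-cong : ∀ xs {F G : Subset n → ℕ} → (∀ S → F S ≡ G S) → sumSubsetsOf xs F ≡ sumSubsetsOf xs G
  sumSubsetsOf-cong []       eq = eq ⊥
  sumSubsetsOf-cong (x ∷ xs) eq =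
    cong₂ _+_ (sumSubsetsOf-cong xs (λ S → eq (⁅ x ⁆ ∪ S))) (sumSubsetsOf-cong xs eq)

  -- 2^m times the expectation of F(R_s) for the arrival order σ and s ~ Bin(m, 1/2).
  binomialPrefixSum : ℕ → List (Fin n) → (Subset n → ℕ) → ℕ
  binomialPrefixSum m σ F = ∑[ s < suc m ] ((m C s) * F (elems (take s σ)))

  ∑-binomialPrefixSum-insertions :
    ∀ x {L} σ (F : Subset n → ℕ) → length σ ≡ L →
    ∑[ τ ∈ insertions x σ ] binomialPrefixSum (suc L) τ F ≡
    suc L * (binomialPrefixSum L σ (λ S → F (⁅ x ⁆ ∪ S)) + binomialPrefixSum L σ F)
  ∑-binomialPrefixSum-insertions x {L} σ F refl = begin
    ∑[ τ ∈ insertions x σ ] ∑[ s < suc (suc L) ] ((suc L C s) * F (elems (take s τ)))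
      ≡⟨ ∑-comm (insertions x σ) (upTo (suc (suc L))) _ ⟩
    ∑[ s < suc (suc L) ] ∑[ τ ∈ insertions x σ ] ((suc L C s) * F (elems (take s τ)))
      ≡⟨ ∑-cong (upTo (suc (suc L))) (λ {s} s∈ → trans (∑-distribˡ-* (insertions x σ) (suc L C s) _)
                                        (cong ((suc L C s) *_) (∑-insertions x σ s F (≤-pred (∈-upTo⁻ s∈))))) ⟩
    ∑[ s < suc (suc L) ] ((suc L C s) * (s * a s + (suc L ∸ s) * b s))
      ≡⟨ ∑-cong (upTo (suc (suc L))) (λ {s} _ → distribute (suc L C s) s (suc L ∸ s) (a s) (b s)) ⟩
    ∑[ s < suc (suc L) ] ((suc L C s) * s * a s + (suc L C s) * (suc L ∸ s) * b s)
      ≡⟨ ∑-distrib-+ (upTo (suc (suc L))) (λ s → (suc L C s) * s * a s)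
                                          (λ s → (suc L C s) * (suc L ∸ s) * b s) ⟩
    ∑[ s < suc (suc L) ] ((suc L C s) * s * a s) + ∑[ s < suc (suc L) ] ((suc L C s) * (suc L ∸ s) * b s)
      ≡⟨ cong₂ _+_ (∑-[1+n]Cs*s L a) (∑-[1+n]Cs*[1+n∸s] L b) ⟩
    suc L * binomialPrefixSum L σ (λ S → F (⁅ x ⁆ ∪ S)) + suc L * binomialPrefixSum L σ F
      ≡⟨ *-distribˡ-+ (suc L) (binomialPrefixSum L σ (λ S → F (⁅ x ⁆ ∪ S))) (binomialPrefixSum L σ F) ⟨
    suc L * (binomialPrefixSum L σ (λ S → F (⁅ x ⁆ ∪ S)) + binomialPrefixSum L σ F)
      ∎
    where
    open ≡-Reasoning
    a b : ℕ → ℕ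
    a s = F (⁅ x ⁆ ∪ elems (take (pred s) σ))
    b s = F (elems (take s σ))
    distribute : ∀ c s d a b → c * (s * a + d * b) ≡ c * s * a + c * d * b
    distribute = solve-∀

  ∑-binomialPrefixSum-perms : ∀ xs (F : Subset n → ℕ) →
    ∑[ σ ∈ perms xs ] binomialPrefixSum (length xs) σ F ≡ length xs ! * sumSubsetsOf xs F
  ∑-binomialPrefixSum-perms []       F = trans (+-identityʳ _) (+-identityʳ _)
  ∑-binomialPrefixSum-perms (x ∷ xs) F = begin
    ∑[ τ ∈ concatMap (insertions x) (perms xs) ] binomialPrefixSum (suc m) τ F
      ≡⟨ ∑-concatMap (insertions x) (perms xs) _ ⟩
    ∑[ σ ∈ perms xs ] ∑[ τ ∈ insertions x σ ] binomialPrefixSum (suc m) τ F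
      ≡⟨ ∑-cong (perms xs) (λ {σ} σ∈ →
           ∑-binomialPrefixSum-insertions x σ F (All.lookup (length-perms xs) σ∈)) ⟩
    ∑[ σ ∈ perms xs ] (suc m * (binomialPrefixSum m σ Fx + binomialPrefixSum m σ F))
      ≡⟨ ∑-distribˡ-* (perms xs) (suc m) _ ⟩
    suc m * ∑[ σ ∈ perms xs ] (binomialPrefixSum m σ Fx + binomialPrefixSum m σ F)
      ≡⟨ cong (suc m *_) (∑-distrib-+ (perms xs) _ _) ⟩
    suc m * (∑[ σ ∈ perms xs ] binomialPrefixSum m σ Fx + ∑[ σ ∈ perms xs ] binomialPrefixSum m σ F)
      ≡⟨ cong (suc m *_) (cong₂ _+_ (∑-binomialPrefixSum-perms xs Fx) (∑-binomialPrefixSum-perms xs F)) ⟩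
    suc m * (m ! * sumSubsetsOf xs Fx + m ! * sumSubsetsOf xs F)
      ≡⟨ factor (suc m) (m !) _ _ ⟩
    suc m ! * sumSubsetsOf (x ∷ xs) F
      ∎
    where
    open ≡-Reasoning
    m = length xs
    Fx : Subset n → ℕ
    Fx S = F (⁅ x ⁆ ∪ S)
    factor : ∀ k f u v → k * (f * u + f * v) ≡ k * f * (u + v)
    factor = solve-∀

sumSubsetsOf-map-suc : ∀ {n} xs (F : Subset (suc n) → ℕ) →
                       sumSubsetsOf (map Fin.suc xs) F ≡ sumSubsetsOf xs (λ S → F (false Vec.∷ S))
sumSubsetsOf-map-suc []       F = refl
sumSubsetsOf-map-suc (x ∷ xs) F =
  cong₂ _+_ (sumSubsetsOf-map-suc xs (λ S → F (⁅ Fin.suc x ⁆ ∪ S))) (sumSubsetsOf-map-suc xs F)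

sumSubsetsOf-allFin-suc : ∀ n (F : Subset (suc n) → ℕ) →
  sumSubsetsOf (allFin (suc n)) F ≡
  sumSubsetsOf (allFin n) (λ S → F (true Vec.∷ S)) + sumSubsetsOf (allFin n) (λ S → F (false Vec.∷ S))
sumSubsetsOf-allFin-suc n F = begin
  sumSubsetsOf (Fin.zero ∷ tabulate Fin.suc) F
    ≡⟨ cong (λ xs → sumSubsetsOf (Fin.zero ∷ xs) F) (map-tabulate (λ i → i) Fin.suc) ⟨
  sumSubsetsOf (map Fin.suc (allFin n)) (λ S → F (⁅ Fin.zero ⁆ ∪ S)) + sumSubsetsOf (map Fin.suc (allFin n)) F
    ≡⟨ cong₂ _+_ (sumSubsetsOf-map-suc (allFin n) _) (sumSubsetsOf-map-suc (allFin n) F) ⟩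
  sumSubsetsOf (allFin n) (λ S → F (true Vec.∷ (⊥ ∪ S))) + sumSubsetsOf (allFin n) (λ S → F (false Vec.∷ S))
    ≡⟨ cong (_+ sumSubsetsOf (allFin n) (λ S → F (false Vec.∷ S)))
            (sumSubsetsOf-cong (allFin n) (λ S → cong (λ T → F (true Vec.∷ T)) (∪-identityˡ S))) ⟩
  sumSubsetsOf (allFin n) (λ S → F (true Vec.∷ S)) + sumSubsetsOf (allFin n) (λ S → F (false Vec.∷ S))
    ∎
  where open ≡-Reasoning

∑-allBits : ∀ n (F : Subset n → ℕ) → ∑[ X ∈ allBits n ] F (Vec.map not X) ≡ sumSubsetsOf (allFin n) F
∑-allBits zero    F = +-identityʳ (F Vec.[])
∑-allBits (suc n) F = begin
  ∑[ X ∈ allBits (suc n) ] F (Vec.map not X)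
    ≡⟨ ∑-concatMap (λ v → (false Vec.∷ v) ∷ (true Vec.∷ v) ∷ []) (allBits n) (λ X → F (Vec.map not X)) ⟩
  ∑[ v ∈ allBits n ] (F₁ (Vec.map not v) + (F₀ (Vec.map not v) + 0))
    ≡⟨ ∑-cong (allBits n) (λ {v} _ → cong (F₁ (Vec.map not v) +_) (+-identityʳ _)) ⟩
  ∑[ v ∈ allBits n ] (F₁ (Vec.map not v) + F₀ (Vec.map not v))
    ≡⟨ ∑-distrib-+ (allBits n) (λ v → F₁ (Vec.map not v)) (λ v → F₀ (Vec.map not v)) ⟩
  ∑[ v ∈ allBits n ] F₁ (Vec.map not v) + ∑[ v ∈ allBits n ] F₀ (Vec.map not v)
    ≡⟨ cong₂ _+_ (∑-allBits n F₁) (∑-allBits n F₀) ⟩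
  sumSubsetsOf (allFin n) F₁ + sumSubsetsOf (allFin n) F₀
    ≡⟨ sumSubsetsOf-allFin-suc n F ⟨
  sumSubsetsOf (allFin (suc n)) F
    ∎
  where
  open ≡-Reasoning
  F₀ F₁ : Subset n → ℕ
  F₀ S = F (false Vec.∷ S)
  F₁ S = F (true Vec.∷ S)

-- The greedy algorithm

module _ {n : ℕ} (M : Matroid n) where

  greedyStep : Subset n → Subset n → Fin n → Subset n
  greedyStep Q B i = if lookup Q i ∧ does (indep? M (⁅ i ⁆ ∪ B)) then ⁅ i ⁆ ∪ B else B

  greedy : Subset n → List (Fin n) → Subset n
  greedy Q = foldl (greedyStep Q) ⊥

  -- The step functions of OPT and processB are local to their where-blocks; these witnesses
  -- expose them.
  private
    OPT-step : ∀ Q → ∃ λ step → OPT M Q ≡ foldl step ⊥ (allFin n)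
    OPT-step Q = _ , refl

  OPT≡greedy : ∀ Q → OPT M Q ≡ greedy Q (allFin n)
  OPT≡greedy Q = foldl-cong agrees ⊥ (allFin n)
    where
    agrees : ∀ B i → proj₁ (OPT-step Q) B i ≡ greedyStep Q B i
    agrees B i rewrite sym (does-∈? i Q) with i ∈? Q | indep? M (⁅ i ⁆ ∪ B)
    ... | yes _ | yes _ = refl
    ... | yes _ | no  _ = refl
    ... | no  _ | _     = refl

  greedy-∷ʳ : ∀ Q l x → greedy Q (l ∷ʳ x) ≡ greedyStep Q (greedy Q l) x
  greedy-∷ʳ Q l x = foldl-∷ʳ (greedyStep Q) ⊥ x l

  foldl-greedyStep-Indep : ∀ Q {B} l → Indep M B → Indep M (foldl (greedyStep Q) B l)
  foldl-greedyStep-Indep Q         []      ind = ind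
  foldl-greedyStep-Indep Q {B} (i ∷ l) ind = foldl-greedyStep-Indep Q l step-Indep
    where
    step-Indep : Indep M (greedyStep Q B i)
    step-Indep with lookup Q i | indep? M (⁅ i ⁆ ∪ B)
    ... | true  | yes ind′ = ind′
    ... | true  | no  _    = ind
    ... | false | _        = ind

  greedy-Indep : ∀ Q l → Indep M (greedy Q l)
  greedy-Indep Q l = foldl-greedyStep-Indep Q l (indep-∅ M)

  greedy-⊆-elems : ∀ Q l → greedy Q l ⊆ elems l
  greedy-⊆-elems Q l = go (reverseView l)
    where
    go : ∀ {l} → Reverse l → greedy Q l ⊆ elems l
    go []             = λ x∈⊥ → x∈⊥
    go (l ∶ r ∶ʳ x) rewrite greedy-∷ʳ Q l x | elems-∷ʳ l x = step (greedy Q l) (go r)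
      where
      step : ∀ B → B ⊆ elems l → greedyStep Q B x ⊆ ⁅ x ⁆ ∪ elems l
      step B B⊆ with lookup Q x ∧ does (indep? M (⁅ x ⁆ ∪ B))
      ... | true  = x∈p∪q⁺ ∘ Sum.map₂ B⊆ ∘ x∈p∪q⁻ ⁅ x ⁆ B
      ... | false = x∈p∪q⁺ ∘ inj₂ ∘ B⊆

  lookup-foldl-greedyStep : ∀ Q B l {x} → x List.∉ l → lookup (foldl (greedyStep Q) B l) x ≡ lookup B x
  lookup-foldl-greedyStep Q B []      x∉ = refl
  lookup-foldl-greedyStep Q B (z ∷ l) {x} x∉ = begin
    lookup (foldl (greedyStep Q) (greedyStep Q B z) l) x  ≡⟨ lookup-foldl-greedyStep Q _ l (x∉ ∘ there) ⟩
    lookup (greedyStep Q B z) x                           ≡⟨ lookup-if-∪ _ z x B ⟩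
    (c ∧ does (z ≟ x)) ∨ lookup B x
      ≡⟨ cong (λ b → (c ∧ b) ∨ lookup B x) (dec-false (z ≟ x) (x∉ ∘ here ∘ sym)) ⟩
    (c ∧ false) ∨ lookup B x                              ≡⟨ cong (_∨ lookup B x) (∧-zeroʳ c) ⟩
    lookup B x                                            ∎
    where
    open ≡-Reasoning
    c = lookup Q z ∧ does (indep? M (⁅ z ⁆ ∪ B))

  foldl-greedyStep-cong : ∀ Q Q′ B l → (∀ {z} → z List.∈ l → lookup Q z ≡ lookup Q′ z) →
                          foldl (greedyStep Q) B l ≡ foldl (greedyStep Q′) B l
  foldl-greedyStep-cong Q Q′ B []      eq = refl
  foldl-greedyStep-cong Q Q′ B (z ∷ l) eq = begin
    foldl (greedyStep Q) (greedyStep Q B z) l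
      ≡⟨ cong (λ b → foldl (greedyStep Q) (if b ∧ _ then ⁅ z ⁆ ∪ B else B) l) (eq (here refl)) ⟩
    foldl (greedyStep Q) (greedyStep Q′ B z) l
      ≡⟨ foldl-greedyStep-cong Q Q′ _ l (eq ∘ there) ⟩
    foldl (greedyStep Q′) (greedyStep Q′ B z) l ∎
    where open ≡-Reasoning

  greedy-of-Indep : ∀ {V} → Indep M V → ∀ l → greedy V l ≡ V ∩ elems l
  greedy-of-Indep {V} indV l = go (reverseView l)
    where
    go : ∀ {l} → Reverse l → greedy V l ≡ V ∩ elems l
    go []           = sym (∩-zeroʳ V)
    go (l ∶ r ∶ʳ x) = begin
      greedy V (l ∷ʳ x)                                   ≡⟨ greedy-∷ʳ V l x ⟩
      greedyStep V (greedy V l) x                         ≡⟨ cong (λ B → greedyStep V B x) (go r) ⟩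
      greedyStep V (V ∩ elems l) x                        ≡⟨ add-if-in-V ⟩
      (if lookup V x then ⁅ x ⁆ else ⊥) ∪ (V ∩ elems l)   ≡⟨ cong (_∪ (V ∩ elems l)) (⁅⁆-∩ x V) ⟨
      (⁅ x ⁆ ∩ V) ∪ (V ∩ elems l)                         ≡⟨ cong (_∪ (V ∩ elems l)) (∩-comm ⁅ x ⁆ V) ⟩
      (V ∩ ⁅ x ⁆) ∪ (V ∩ elems l)                         ≡⟨ ∩-distribˡ-∪ V ⁅ x ⁆ (elems l) ⟨
      V ∩ (⁅ x ⁆ ∪ elems l)                               ≡⟨ cong (V ∩_) (elems-∷ʳ l x) ⟨
      V ∩ elems (l ∷ʳ x)                                  ∎
      where
      open ≡-Reasoning
      ⊆V : lookup V x ≡ true → ⁅ x ⁆ ∪ (V ∩ elems l) ⊆ V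
      ⊆V x∈V y∈ with x∈p∪q⁻ ⁅ x ⁆ _ y∈
      ... | inj₁ y∈⁅x⁆ rewrite x∈⁅y⁆⇒x≡y x y∈⁅x⁆ = lookup⇒[]= x V x∈V
      ... | inj₂ y∈V∩L = p∩q⊆p V (elems l) y∈V∩L
      add-if-in-V : greedyStep V (V ∩ elems l) x ≡ (if lookup V x then ⁅ x ⁆ else ⊥) ∪ (V ∩ elems l)
      add-if-in-V with lookup V x in x∈V
      ... | true  rewrite dec-true (indep? M (⁅ x ⁆ ∪ (V ∩ elems l))) (hereditary M (⊆V x∈V) indV)
                  = refl
      ... | false = sym (∪-identityˡ _)

  greedy-idem : ∀ Q l → greedy (greedy Q l) l ≡ greedy Q l
  greedy-idem Q l = trans (greedy-of-Indep (greedy-Indep Q l) l) (p⊆q⇒p∩q≡p (greedy-⊆-elems Q l))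

  lookup-greedy-at : ∀ Q l {x} post → x List.∉ l → x List.∉ post →
                     lookup (greedy Q (l ++ x ∷ post)) x ≡
                     lookup Q x ∧ does (indep? M (⁅ x ⁆ ∪ greedy Q l))
  lookup-greedy-at Q l {x} post x∉l x∉post = begin
    lookup (greedy Q (l ++ x ∷ post)) x
      ≡⟨ cong (λ S → lookup S x) (foldl-++ (greedyStep Q) ⊥ l (x ∷ post)) ⟩
    lookup (foldl (greedyStep Q) (greedyStep Q G x) post) x   ≡⟨ lookup-foldl-greedyStep Q _ post x∉post ⟩
    lookup (greedyStep Q G x) x                               ≡⟨ lookup-if-∪ c x x G ⟩
    (c ∧ does (x ≟ x)) ∨ lookup G x
      ≡⟨ cong₂ (λ b b′ → (c ∧ b) ∨ b′) (dec-true (x ≟ x) refl) G-x ⟩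
    (c ∧ true) ∨ false                                        ≡⟨ trans (∨-identityʳ _) (∧-identityʳ c) ⟩
    c                                                         ∎
    where
    open ≡-Reasoning
    G = greedy Q l
    c = lookup Q x ∧ does (indep? M (⁅ x ⁆ ∪ G))
    G-x : lookup G x ≡ false
    G-x = trans (lookup-foldl-greedyStep Q ⊥ l x∉l) (lookup-replicate x false)

  lookup-OPT-∪⁅⁆ : ∀ Q l {x} post → l ++ x ∷ post ≡ allFin n →
                    lookup (OPT M (Q ∪ ⁅ x ⁆)) x ≡ does (indep? M (⁅ x ⁆ ∪ greedy Q l))
  lookup-OPT-∪⁅⁆ Q l {x} post l++x∷post≡ = begin
    lookup (OPT M (Q ∪ ⁅ x ⁆)) x
      ≡⟨ cong (λ S → lookup S x) (trans (OPT≡greedy (Q ∪ ⁅ x ⁆))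
                                         (cong (greedy (Q ∪ ⁅ x ⁆)) (sym l++x∷post≡))) ⟩
    lookup (greedy (Q ∪ ⁅ x ⁆) (l ++ x ∷ post)) x
      ≡⟨ lookup-greedy-at (Q ∪ ⁅ x ⁆) l post x∉l x∉post ⟩
    lookup (Q ∪ ⁅ x ⁆) x ∧ does (indep? M (⁅ x ⁆ ∪ greedy (Q ∪ ⁅ x ⁆) l))
      ≡⟨ cong₂ (λ b B → b ∧ does (indep? M (⁅ x ⁆ ∪ B)))
               x∈Q∪⁅x⁆ (foldl-greedyStep-cong (Q ∪ ⁅ x ⁆) Q ⊥ l same-on-l) ⟩
    does (indep? M (⁅ x ⁆ ∪ greedy Q l))
      ∎
    where
    open ≡-Reasoning
    x∉ = Unique[xs++x∷ys]⇒x∉xs×x∉ys l post (subst Unique (sym l++x∷post≡) (allFin⁺ n))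
    x∉l = proj₁ x∉
    x∉post = proj₂ x∉
    x∈Q∪⁅x⁆ : lookup (Q ∪ ⁅ x ⁆) x ≡ true
    x∈Q∪⁅x⁆ = trans (lookup-∪⁅⁆ Q x x) (trans (cong (lookup Q x ∨_) (dec-true (x ≟ x) refl)) (∨-zeroʳ _))
    same-on-l : ∀ {z} → z List.∈ l → lookup (Q ∪ ⁅ x ⁆) z ≡ lookup Q z
    same-on-l {z} z∈l = trans (lookup-∪⁅⁆ Q x z)
      (trans (cong (lookup Q z ∨_) (dec-false (x ≟ z) λ { refl → x∉l z∈l })) (∨-identityʳ _))

  -- The coin process

  mem≡lookup : ∀ x Q → mem M x Q ≡ lookup Q x
  mem≡lookup x Q with x ∈? Q | does-∈? x Q
  ... | yes _ | eq = eq
  ... | no  _ | eq = eq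

  lookup-Rs⁺ : ∀ S x → lookup (Rs⁺ M S) x ≡ not (lookup S x) ∧ lookup (OPT M (S ∪ ⁅ x ⁆)) x
  lookup-Rs⁺ S x
    rewrite lookup∘tabulate (λ r → if mem M r S then false else mem M r (OPT M (S ∪ ⁅ r ⁆))) x
          | mem≡lookup x S | mem≡lookup x (OPT M (S ∪ ⁅ x ⁆))
    with lookup S x
  ... | true  = refl
  ... | false = refl

  coinStep : Vec Bool n → Subset n × Subset n → Fin n → Subset n × Subset n
  coinStep X (V , W) i =
    if mem M i (OPT M (V ∪ ⁅ i ⁆))
    then (if lookup X i then (V , W ∪ ⁅ i ⁆) else (V ∪ ⁅ i ⁆ , W))
    else (V , W)

  private
    processB-step : ∀ X → ∃ λ step → processB M X ≡ foldl step (⊥ , ⊥) (allFin n)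
    processB-step X = _ , refl

  processB≡foldl-coinStep : ∀ X → processB M X ≡ foldl (coinStep X) (⊥ , ⊥) (allFin n)
  processB≡foldl-coinStep X = foldl-cong agrees (⊥ , ⊥) (allFin n)
    where
    agrees : ∀ VW i → proj₁ (processB-step X) VW i ≡ coinStep X VW i
    agrees (V , W) i with mem M i (OPT M (V ∪ ⁅ i ⁆)) | lookup X i
    ... | true  | true  = refl
    ... | true  | false = refl
    ... | false | _     = refl

  module _ (X : Vec Bool n) where

    private
      S R : Subset n
      S = Vec.map not X
      R = Rs⁺ M S

    coinStep-at : ∀ V W x (d : Bool) → mem M x (OPT M (V ∪ ⁅ x ⁆)) ≡ d →
                  coinStep X (V , W) x ≡
                  ( (if not (lookup X x) ∧ d then ⁅ x ⁆ ∪ V else V)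
                  , (if lookup X x ∧ d then ⁅ x ⁆ else ⊥) ∪ W )
    coinStep-at V W x d x∈OPT rewrite x∈OPT with lookup X x | d
    ... | true  | true  = cong (V ,_) (∪-comm W ⁅ x ⁆)
    ... | false | true  = cong₂ _,_ (∪-comm V ⁅ x ⁆) (sym (∪-identityˡ W))
    ... | true  | false = cong (V ,_) (sym (∪-identityˡ W))
    ... | false | false = cong (V ,_) (sym (∪-identityˡ W))

    coinStep-extends : ∀ l x post → l ++ x ∷ post ≡ allFin n →
                       coinStep X (greedy S l , elems l ∩ R) x ≡
                       (greedy S (l ∷ʳ x) , elems (l ∷ʳ x) ∩ R)
    coinStep-extends l x post l++x∷post≡ =
      trans (coinStep-at V (elems l ∩ R) x d x-in-OPT) (sym (cong₂ _,_ V-extends W-extends))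
      where
      open ≡-Reasoning
      V = greedy S l
      d = does (indep? M (⁅ x ⁆ ∪ V))
      x-in-OPT : mem M x (OPT M (V ∪ ⁅ x ⁆)) ≡ d
      x-in-OPT = trans (mem≡lookup x _) (trans (lookup-OPT-∪⁅⁆ V l post l++x∷post≡)
                                                (cong (λ B → does (indep? M (⁅ x ⁆ ∪ B))) (greedy-idem S l)))
      x-in-R : lookup R x ≡ lookup X x ∧ d
      x-in-R = trans (lookup-Rs⁺ S x) (cong₂ _∧_ (trans (cong not (lookup-map x not X)) (not-involutive _))
                                                 (lookup-OPT-∪⁅⁆ S l post l++x∷post≡))
      V-extends : greedy S (l ∷ʳ x) ≡ (if not (lookup X x) ∧ d then ⁅ x ⁆ ∪ V else V)
      V-extends =
        trans (greedy-∷ʳ S l x) (cong (λ b → if b ∧ d then ⁅ x ⁆ ∪ V else V) (lookup-map x not X))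
      W-extends : elems (l ∷ʳ x) ∩ R ≡ (if lookup X x ∧ d then ⁅ x ⁆ else ⊥) ∪ (elems l ∩ R)
      W-extends = begin
        elems (l ∷ʳ x) ∩ R                                  ≡⟨ cong (_∩ R) (elems-∷ʳ l x) ⟩
        (⁅ x ⁆ ∪ elems l) ∩ R                               ≡⟨ ∩-distribʳ-∪ R ⁅ x ⁆ (elems l) ⟩
        (⁅ x ⁆ ∩ R) ∪ (elems l ∩ R)                         ≡⟨ cong (_∪ (elems l ∩ R)) (⁅⁆-∩ x R) ⟩
        (if lookup R x then ⁅ x ⁆ else ⊥) ∪ (elems l ∩ R)
          ≡⟨ cong (λ b → (if b then ⁅ x ⁆ else ⊥) ∪ (elems l ∩ R)) x-in-R ⟩
        (if lookup X x ∧ d then ⁅ x ⁆ else ⊥) ∪ (elems l ∩ R) ∎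

    foldl-coinStep-prefix : ∀ {l} → Reverse l → ∀ post → l ++ post ≡ allFin n →
                            foldl (coinStep X) (⊥ , ⊥) l ≡ (greedy S l , elems l ∩ R)
    foldl-coinStep-prefix []           post _   = cong (⊥ ,_) (sym (∩-zeroˡ R))
    foldl-coinStep-prefix (l ∶ r ∶ʳ x) post eq = begin
      foldl (coinStep X) (⊥ , ⊥) (l ∷ʳ x)               ≡⟨ foldl-∷ʳ (coinStep X) (⊥ , ⊥) x l ⟩
      coinStep X (foldl (coinStep X) (⊥ , ⊥) l) x
        ≡⟨ cong (λ VW → coinStep X VW x) (foldl-coinStep-prefix r (x ∷ post) eq′) ⟩
      coinStep X (greedy S l , elems l ∩ R) x           ≡⟨ coinStep-extends l x post eq′ ⟩
      (greedy S (l ∷ʳ x) , elems (l ∷ʳ x) ∩ R)          ∎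
      where
      open ≡-Reasoning
      eq′ : l ++ x ∷ post ≡ allFin n
      eq′ = trans (sym (++-assoc l (x ∷ []) post)) eq

    processB≡ : processB M X ≡ (OPT M S , Rs⁺ M S)
    processB≡ = begin
      processB M X
        ≡⟨ processB≡foldl-coinStep X ⟩
      foldl (coinStep X) (⊥ , ⊥) (allFin n)
        ≡⟨ foldl-coinStep-prefix (reverseView (allFin n)) [] (++-identityʳ _) ⟩
      (greedy S (allFin n) , elems (allFin n) ∩ R)
        ≡⟨ cong₂ _,_ (sym (OPT≡greedy S)) (trans (cong (_∩ R) elems-allFin) (∩-identityˡ R)) ⟩
      (OPT M S , R)
        ∎
      where open ≡-Reasoning

-- Comparing the two distributions

indicator : Bool → ℕ
indicator b = if b then 1 else 0

if-then-0≡*indicator : ∀ b c → (if b then c else 0) ≡ c * indicator b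
if-then-0≡*indicator true  c = sym (*-identityʳ c)
if-then-0≡*indicator false c = sym (*-zeroʳ c)

length-filter : ∀ {A : Set} {P : A → Set} (P? : Decidable P) l →
                length (filter P? l) ≡ ∑[ a ∈ l ] indicator (does (P? a))
length-filter P? []      = refl
length-filter P? (a ∷ l) with does (P? a)
... | true  = cong suc (length-filter P? l)
... | false = length-filter P? l

module _ {n : ℕ} (M : Matroid n) (p : Subset n × Subset n) where

  matchesOutcome : Subset n → ℕ
  matchesOutcome S = indicator (does ((OPT M S , Rs⁺ M S) ≟P p))

  probB-num≡ : probB-num M p ≡ sumSubsetsOf (allFin n) matchesOutcome
  probB-num≡ = begin
    probB-num M p
      ≡⟨ length-filter (λ X → processB M X ≟P p) (allBits n) ⟩
    ∑[ X ∈ allBits n ] indicator (does (processB M X ≟P p))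
      ≡⟨ ∑-cong (allBits n) (λ {X} _ → cong (λ q → indicator (does (q ≟P p))) (processB≡ M X)) ⟩
    ∑[ X ∈ allBits n ] matchesOutcome (Vec.map not X)
      ≡⟨ ∑-allBits n matchesOutcome ⟩
    sumSubsetsOf (allFin n) matchesOutcome
      ∎
    where open ≡-Reasoning

  probA-num≡ : probA-num M p ≡ n ! * sumSubsetsOf (allFin n) matchesOutcome
  probA-num≡ = begin
    probA-num M p
      ≡⟨ sum-concatMap _ (perms (allFin n)) ⟩
    ∑[ σ ∈ perms (allFin n) ] ∑[ s < suc n ] (if does (processA M σ s ≟P p) then n C s else 0)
      ≡⟨ ∑-cong (perms (allFin n)) (λ _ → ∑-cong (upTo (suc n)) (λ {s} _ → if-then-0≡*indicator _ (n C s))) ⟩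
    ∑[ σ ∈ perms (allFin n) ] binomialPrefixSum n σ matchesOutcome
      ≡⟨ subst (λ m → ∑[ σ ∈ perms (allFin n) ] binomialPrefixSum m σ matchesOutcome ≡
                      m ! * sumSubsetsOf (allFin n) matchesOutcome)
               (length-tabulate {n = n} (λ i → i)) (∑-binomialPrefixSum-perms (allFin n) matchesOutcome) ⟩
    n ! * sumSubsetsOf (allFin n) matchesOutcome
      ∎
    where open ≡-Reasoning

lemma12 : (n : ℕ) (M : Matroid n) (p : Subset n × Subset n) →
    probA-num M p * denomB n ≡ probB-num M p * denomA n
lemma12 n M p = begin
  probA-num M p * 2 ^ n                      ≡⟨ cong (_* 2 ^ n) (probA-num≡ M p) ⟩
  n ! * K * 2 ^ n                            ≡⟨ cong (_* 2 ^ n) (*-comm (n !) K) ⟩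
  K * n ! * 2 ^ n                            ≡⟨ *-assoc K (n !) (2 ^ n) ⟩
  K * (n ! * 2 ^ n)                          ≡⟨ cong (_* denomA n) (probB-num≡ M p) ⟨
  probB-num M p * denomA n                   ∎
  where
  open ≡-Reasoning
  K = sumSubsetsOf (allFin n) (matchesOutcome M p)
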